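{- Let $P$ be a finite set partially ordered by $\leq$. For every family $(N_m,E_m,\lambda_m)_{m\in\mathbb{N}}$ of $P$-labelled trees there exists $n\in\mathbb{N}$ such that the finite family $(N_m,E_m,\lambda_m)_{1\leq m\leq n}$ is dreary, i.e. there is $m$ with $1\leq m<n$ and $(N_m,E_m,\lambda_m)\sim(N_n,E_n,\lambda_n)$.
   Context: A $P$-labelled tree is a triple $(N,E,\lambda)$ where $(N,E)$ is a finite (rooted) tree with edge relation $E$ (parent to child) and $\lambda:N\to P$ satisfies $\lambda(i)\leq\lambda(j)$ whenever $iEj$. A $P$-embedding of $(N,E,\lambda)$ into $(N',E',\lambda')$ is a function $f:N\to N'$ such that $iEj$ implies $f(i)\,E'^{\star}\,f(j)$ (where $E'^{\star}$ is the reflexive-transitive closure of $E'$) and $\lambda(k)=\lambda'(f(k))$ for all $k\in N$. Two $P$-labelled trees are related by $\sim$ iff there is a $P$-embedding of each into the other. -}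

module Defs where

open import Level using (0ℓ)
open import Data.Nat using (ℕ; _≤_; _<_)
open import Data.Fin using (Fin)
open import Data.Product using (Σ; ∃; ∃-syntax; _×_)
open import Function.Bundles using (_↔_)
open import Relation.Nullary using (¬_)
open import Relation.Binary.Core using (Rel)
open import Relation.Binary.Definitions using (Decidable)
open import Relation.Binary.Structures using (IsPartialOrder)
open import Relation.Binary.PropositionalEquality using (_≡_; _≢_)
open import Relation.Binary.Construct.Closure.ReflexiveTransitive using (Star)

record FinitePoset : Set₁ where
  field
    Carrier        : Set
    _≤P_           : Rel Carrier 0ℓ
    isPartialOrder : IsPartialOrder _≡_ _≤P_
    size           : ℕ
    finite         : Carrier ↔ Fin size

record IsRootedTree {k : ℕ} (E : Rel (Fin k) 0ℓ) : Set where
  field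
    root          : Fin k
    root-orphan   : ∀ i → ¬ E i root
    unique-parent : ∀ j → j ≢ root →
                    ∃[ i ] (E i j × (∀ i′ → E i′ j → i′ ≡ i))
    reachable     : ∀ j → Star E root j

module _ (P : FinitePoset) where
  open FinitePoset P

  record PTree : Set₁ where
    field
      nodes  : ℕ
      E      : Rel (Fin nodes) 0ℓ
      E?     : Decidable E
      tree   : IsRootedTree E
      label  : Fin nodes → Carrier
      mono   : ∀ {i j} → E i j → label i ≤P label j

  open PTree

  PEmbedding : PTree → PTree → Set
  PEmbedding T T′ =
    Σ (Fin (nodes T) → Fin (nodes T′)) λ f →
      (∀ {i j} → E T i j → Star (E T′) (f i) (f j)) ×
      (∀ k → label T k ≡ label T′ (f k))

  _∼_ : PTree → PTree → Set
  T ∼ T′ = PEmbedding T T′ × PEmbedding T′ T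

  Dreary : (ℕ → PTree) → ℕ → Set
  Dreary T n = ∃[ m ] (1 ≤ m × m < n × T m ∼ T n)

-- Labels weakly increase along edges, and a strictly increasing chain in P has at
-- most |P| elements, so from any node there are at most |P| successive changes of
-- label going down the tree.  Summarise a node u by its code: the label of u
-- together with the set of codes of those descendants of u whose label differs
-- from that of u, computed to depth |P|.  There are finitely many codes, so by
-- pigeonhole two trees T m, T n with 1 ≤ m < n have the same root code.  And a
-- tree whose root code is realised at a node w of another tree embeds into it:
-- walk down the first tree keeping every node on a node realising its code; an
-- edge that keeps the label is mapped to a point, and an edge that changes it to
-- a downward path towards a node realising the code of the child.
module Submission where

open import Defs
open import Data.Nat using (ℕ)
open import Data.Product using (∃-syntax)

open import Level using (0ℓ)
open import Function using (_∘_; id)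
open import Function.Bundles using (Inverse; Injection)
open import Function.Properties.Inverse using (↔⇒↣)
open import Data.Empty using (⊥-elim)
open import Data.Unit using (⊤; tt)
open import Data.Bool using (true; false)
open import Data.Product using (∃; ∃₂; _×_; _,_; proj₁; proj₂)
open import Data.Nat as ℕ using (suc; zero; z≤n; s≤s)
open import Data.Nat.Properties as ℕ using (n<1+n; ≮⇒≥; 1+n≰n; anyUpTo?)
open import Data.Fin as Fin using (Fin; toℕ)
open import Data.Fin.Properties using (any?; all?; pigeonhole)
open import Data.List using (List; []; _∷_; map; _++_; filter; length; lookup; allFin; cartesianProductWith)
open import Data.List.Membership.Propositional using (_∈_)
open import Data.List.Membership.Propositional.Properties
  using (∈-map⁺; ∈-++⁺ˡ; ∈-++⁺ʳ; ∈-filter⁺; ∈-filter⁻; ∈-allFin; ∈-lookup; ∈-cartesianProductWith⁺)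
import Data.List.Membership.DecPropositional as DecMembership
open import Data.List.Relation.Binary.Subset.Propositional using (_⊆_)
open import Data.List.Relation.Binary.Subset.Propositional.Properties using (filter⁺′)
open import Data.List.Relation.Unary.Any as Any using (here; there)
open import Data.List.Relation.Unary.Any.Properties using (lookup-index)
open import Data.List.Relation.Unary.All as All using (All; []; _∷_)
open import Data.List.Relation.Unary.AllPairs using (AllPairs; _∷_)
open import Data.List.Relation.Unary.Linked using (Linked; [-]; _∷_)
open import Data.List.Relation.Unary.Linked.Properties using (Linked⇒AllPairs)
open import Relation.Nullary using (¬_; Dec; yes; no; does; ¬?; _×-dec_; _→-dec_; contradiction)
open import Relation.Nullary.Decidable using (map′; via-injection; decidable-stable)
open import Relation.Binary.Core using (Rel)
open import Relation.Binary.Definitions using (Decidable; DecidableEquality)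
open import Relation.Binary.Structures using (IsPartialOrder)
open import Relation.Binary.PropositionalEquality using (_≡_; _≢_; refl; sym; trans; cong; subst)
open import Relation.Binary.Construct.Closure.ReflexiveTransitive using (Star; ε; _◅_; _◅◅_; gfold)

sublists : {A : Set} → List A → List (List A)
sublists []       = [] ∷ []
sublists (x ∷ xs) = map (x ∷_) (sublists xs) ++ sublists xs

filter∈sublists : {A : Set} {Q : A → Set} (Q? : ∀ x → Dec (Q x)) (xs : List A) →
                  filter Q? xs ∈ sublists xs
filter∈sublists Q? []       = here refl
filter∈sublists Q? (x ∷ xs) with does (Q? x)
... | true  = ∈-++⁺ˡ (∈-map⁺ (x ∷_) (filter∈sublists Q? xs))
... | false = ∈-++⁺ʳ (map (x ∷_) (sublists xs)) (filter∈sublists Q? xs)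

lookup-AllPairs : {A : Set} {R : Rel A 0ℓ} {xs : List A} → AllPairs R xs →
                  ∀ {i j} → i Fin.< j → R (lookup xs i) (lookup xs j)
lookup-AllPairs (Rx ∷ _)   {Fin.zero}  {Fin.suc j} _         = All.lookup Rx (∈-lookup j)
lookup-AllPairs (_  ∷ Rxs) {Fin.suc i} {Fin.suc j} (s≤s i<j) = lookup-AllPairs Rxs i<j

repetition : {A : Set} (xs : List A) (f : ℕ → A) → (∀ n → f n ∈ xs) →
             ∃₂ λ m n → 1 ℕ.≤ m × m ℕ.< n × f m ≡ f n
repetition xs f f∈xs
  with pigeonhole (n<1+n (length xs)) (λ i → Any.index (f∈xs (suc (toℕ i))))
... | i , j , i<j , same-index =
  suc (toℕ i) , suc (toℕ j) , s≤s z≤n , s≤s i<j ,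
  trans (lookup-index (f∈xs _)) (trans (cong (lookup xs) same-index) (sym (lookup-index (f∈xs _))))

module RootedTree {k : ℕ} {E : Rel (Fin k) 0ℓ} (tree : IsRootedTree E) where
  open IsRootedTree tree
  open DecMembership (Fin._≟_ {k}) using (_∈?_)

  data Path : Fin k → Set where
    origin : Path root
    _▸_    : ∀ {i j} → Path i → E i j → Path j

  extend : ∀ {i j} → Path i → Star E i j → Path j
  extend p ε       = p
  extend p (e ◅ s) = extend (p ▸ e) s

  pathTo : ∀ j → Path j
  pathTo j = extend origin (reachable j)

  parent-unique : ∀ {i i′ j} → E i j → E i′ j → i ≡ i′
  parent-unique {i} {i′} {j} e e′ with unique-parent j (λ { refl → root-orphan i e })
  ... | _ , _ , unique = trans (unique i e) (sym (unique i′ e′))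

  foldPath : {B : Set} → (Fin k → B → B) → B → ∀ {j} → Path j → B
  foldPath s b origin              = b
  foldPath s b (_▸_ {j = j} p _) = s j (foldPath s b p)

  foldPath-unique : {B : Set} (s : Fin k → B → B) (b : B) →
                    ∀ {j} (p q : Path j) → foldPath s b p ≡ foldPath s b q
  foldPath-unique s b origin  origin   = refl
  foldPath-unique s b origin  (_ ▸ e)  = ⊥-elim (root-orphan _ e)
  foldPath-unique s b (_ ▸ e) origin   = ⊥-elim (root-orphan _ e)
  foldPath-unique s b (p ▸ e) (q ▸ e′) with parent-unique e e′
  ... | refl = cong (s _) (foldPath-unique s b p q)

  nodesOn : ∀ {j} → Path j → List (Fin k)
  nodesOn = foldPath _∷_ (root ∷ [])

  end∈nodesOn : ∀ {j} (p : Path j) → j ∈ nodesOn p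
  end∈nodesOn origin  = here refl
  end∈nodesOn (_ ▸ _) = here refl

  ∈-nodesOn-extend : ∀ {i j l} (p : Path i) (s : Star E i j) → l ∈ nodesOn p → l ∈ nodesOn (extend p s)
  ∈-nodesOn-extend p ε       l∈p = l∈p
  ∈-nodesOn-extend p (e ◅ s) l∈p = ∈-nodesOn-extend (p ▸ e) s (there l∈p)

  ∈-nodesOn⇒Star : ∀ {i j} (p : Path j) → i ∈ nodesOn p → Star E i j
  ∈-nodesOn⇒Star origin  (here refl)  = ε
  ∈-nodesOn⇒Star (p ▸ e) (here refl)  = ε
  ∈-nodesOn⇒Star (p ▸ e) (there i∈p) = ∈-nodesOn⇒Star p i∈p ◅◅ (e ◅ ε)

  ancestors : Fin k → List (Fin k)
  ancestors j = nodesOn (pathTo j)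

  Star⇒∈-ancestors : ∀ {i j} → Star E i j → i ∈ ancestors j
  Star⇒∈-ancestors {i} {j} s =
    subst (i ∈_) (foldPath-unique _∷_ (root ∷ []) (extend (pathTo i) s) (pathTo j))
          (∈-nodesOn-extend (pathTo i) s (end∈nodesOn (pathTo i)))

  Star? : Decidable (Star E)
  Star? i j = map′ (∈-nodesOn⇒Star (pathTo j)) Star⇒∈-ancestors (i ∈? ancestors j)

module _ (P : FinitePoset) where
  open FinitePoset P
  open IsPartialOrder isPartialOrder using () renaming (refl to ≤P-refl; trans to ≤P-trans)
  open import Relation.Binary.Construct.NonStrictToStrict _≡_ _≤P_
    using (<-irrefl; <-trans) renaming (_<_ to _<P_)
  open Inverse finite using (to; from; strictlyInverseʳ)
  open Injection (↔⇒↣ finite) using (injective)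

  _≟_ : DecidableEquality Carrier
  _≟_ = via-injection (↔⇒↣ finite) Fin._≟_

  carriers : List Carrier
  carriers = map from (allFin size)

  ∈-carriers : ∀ x → x ∈ carriers
  ∈-carriers x = subst (_∈ carriers) (strictlyInverseʳ x) (∈-map⁺ from (∈-allFin (to x)))

  strictChain-length≤size : ∀ {xs} → Linked _<P_ xs → length xs ℕ.≤ size
  strictChain-length≤size {xs} chain with size ℕ.<? length xs
  ... | no  size≮length = ≮⇒≥ size≮length
  ... | yes size<length with pigeonhole size<length (to ∘ lookup xs)
  ...   | i , j , i<j , same =
    contradiction (lookup-AllPairs (Linked⇒AllPairs (<-trans isPartialOrder) chain) i<j)
                  (<-irrefl (injective same))

  data Code : Set where
    node : Carrier → List Code → Code

  mutual
    _≟ᶜ_ : DecidableEquality Code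
    node p ds ≟ᶜ node q es with p ≟ q | ds ≟ᶜˢ es
    ... | yes refl | yes refl = yes refl
    ... | no  p≢q  | _        = no λ { refl → p≢q refl }
    ... | yes _    | no ds≢es = no λ { refl → ds≢es refl }

    _≟ᶜˢ_ : DecidableEquality (List Code)
    []       ≟ᶜˢ []       = yes refl
    []       ≟ᶜˢ (_ ∷ _)  = no λ ()
    (_ ∷ _)  ≟ᶜˢ []       = no λ ()
    (c ∷ cs) ≟ᶜˢ (d ∷ ds) with c ≟ᶜ d | cs ≟ᶜˢ ds
    ... | yes refl | yes refl = yes refl
    ... | no  c≢d  | _        = no λ { refl → c≢d refl }
    ... | yes _    | no cs≢ds = no λ { refl → cs≢ds refl }

  codes : ℕ → List Code
  codes zero    = map (λ p → node p []) carriers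
  codes (suc r) = cartesianProductWith node carriers (sublists (codes r))

  module Coding (T : PTree P) where
    open PTree T
    open IsRootedTree tree public using (root)
    open RootedTree tree public using (Path; origin; _▸_; pathTo; foldPath; foldPath-unique; Star?)

    label-mono* : ∀ {i j} → Star E i j → label i ≤P label j
    label-mono* s = gfold label _≤P_ (≤P-trans ∘ mono) ≤P-refl s

    Rise : Rel (Fin nodes) 0ℓ
    Rise u c = Star E u c × label c ≢ label u

    rise? : Decidable Rise
    rise? u c = Star? u c ×-dec ¬? (label c ≟ label u)

    rise⇒<P : ∀ {u c} → Rise u c → label u <P label c
    rise⇒<P (s , c≢u) = label-mono* s , c≢u ∘ sym

    mutual
      ChildCode : ℕ → Fin nodes → Code → Set
      ChildCode r u d = ∃ λ c → Rise u c × code r c ≡ d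

      childCode? : ∀ r u d → Dec (ChildCode r u d)
      childCode? r u d = any? λ c → rise? u c ×-dec (code r c ≟ᶜ d)

      code : ℕ → Fin nodes → Code
      code zero    u = node (label u) []
      code (suc r) u = node (label u) (filter (childCode? r u) (codes r))

    code∈codes : ∀ r u → code r u ∈ codes r
    code∈codes zero    u = ∈-map⁺ (λ p → node p []) (∈-carriers (label u))
    code∈codes (suc r) u =
      ∈-cartesianProductWith⁺ node (∈-carriers (label u)) (filter∈sublists (childCode? r u) (codes r))

    -- RealisesBelowAll w ds is All (RealisesBelow w) ds, unfolded so that the
    -- recursion through the nested lists of a code is structural.
    mutual
      Realises : Fin nodes → Code → Set
      Realises w (node p ds) = label w ≡ p × RealisesBelowAll w ds

      RealisesBelow : Fin nodes → Code → Set
      RealisesBelow w d = ∃ λ w′ → Star E w w′ × Realises w′ d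

      RealisesBelowAll : Fin nodes → List Code → Set
      RealisesBelowAll w []       = ⊤
      RealisesBelowAll w (d ∷ ds) = RealisesBelow w d × RealisesBelowAll w ds

    mutual
      realises? : ∀ w d → Dec (Realises w d)
      realises? w (node p ds) = (label w ≟ p) ×-dec realisesBelowAll? w ds

      realisesBelow? : ∀ w d → Dec (RealisesBelow w d)
      realisesBelow? w d = any? λ w′ → Star? w w′ ×-dec realises? w′ d

      realisesBelowAll? : ∀ w ds → Dec (RealisesBelowAll w ds)
      realisesBelowAll? w []       = yes tt
      realisesBelowAll? w (d ∷ ds) = realisesBelow? w d ×-dec realisesBelowAll? w ds

    RealisesBelowAll⇒All : ∀ {w ds} → RealisesBelowAll w ds → All (RealisesBelow w) ds
    RealisesBelowAll⇒All {ds = []}    tt         = []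
    RealisesBelowAll⇒All {ds = _ ∷ _} (rd , rds) = rd ∷ RealisesBelowAll⇒All rds

    All⇒RealisesBelowAll : ∀ {w ds} → All (RealisesBelow w) ds → RealisesBelowAll w ds
    All⇒RealisesBelowAll []         = tt
    All⇒RealisesBelowAll (rd ∷ rds) = rd , All⇒RealisesBelowAll rds

    realisesBelowAll-⊆ : ∀ {w ds es} → ds ⊆ es → RealisesBelowAll w es → RealisesBelowAll w ds
    realisesBelowAll-⊆ ds⊆es res =
      All⇒RealisesBelowAll (All.tabulate (All.lookup (RealisesBelowAll⇒All res) ∘ ds⊆es))

    realises-code : ∀ r u → Realises u (code r u)
    realises-code zero    u = refl , tt
    realises-code (suc r) u =
      refl , All⇒RealisesBelowAll (All.tabulate (below ∘ proj₂ ∘ ∈-filter⁻ (childCode? r u) {xs = codes r}))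
      where
        below : ∀ {d} → ChildCode r u d → RealisesBelow u d
        below (c , (s , _) , refl) = c , s , realises-code r c

    Height≤ : ℕ → Fin nodes → Set
    Height≤ zero    u = ∀ c → ¬ Rise u c
    Height≤ (suc r) u = ∀ c → Rise u c → Height≤ r c

    height≤? : ∀ r u → Dec (Height≤ r u)
    height≤? zero    u = all? λ c → ¬? (rise? u c)
    height≤? (suc r) u = all? λ c → rise? u c →-dec height≤? r c

    risingChain : ∀ r u → ¬ Height≤ r u → ∃ λ ps → length ps ≡ r × Linked _<P_ (label u ∷ ps)
    risingChain zero    u _  = [] , refl , [-]
    risingChain (suc r) u ¬h with any? (λ c → rise? u c ×-dec ¬? (height≤? r c))
    ... | no ∄ = contradiction (λ c rise → decidable-stable (height≤? r c) λ ¬hc → ∄ (c , rise , ¬hc)) ¬h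
    ... | yes (c , rise , ¬hc) with risingChain r c ¬hc
    ...   | ps , refl , chain = label c ∷ ps , refl , rise⇒<P rise ∷ chain

    height≤size : ∀ u → Height≤ size u
    height≤size u = decidable-stable (height≤? size u) λ ¬h →
      let ps , |ps|≡size , chain = risingChain size u ¬h
      in 1+n≰n (subst (ℕ._≤ size) (cong suc |ps|≡size) (strictChain-length≤size chain))

    module _ {u c} (same : label c ≡ label u) (e : E u c) where

      rise-flat : ∀ {x} → Rise c x → Rise u x
      rise-flat (s , x≢c) = e ◅ s , λ x≡u → x≢c (trans x≡u (sym same))

      height≤-flat : ∀ r → Height≤ r u → Height≤ r c
      height≤-flat zero    h x = h x ∘ rise-flat
      height≤-flat (suc r) h x = h x ∘ rise-flat

      childCodes-flat : ∀ r → filter (childCode? r c) (codes r) ⊆ filter (childCode? r u) (codes r)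
      childCodes-flat r =
        filter⁺′ (childCode? r c) (childCode? r u) (λ (x , rise , x↦d) → x , rise-flat rise , x↦d) {codes r} id

  module Embedding (T T′ : PTree P) where
    private
      module S = Coding T
      module G = Coding T′
    open PTree using (nodes; E; label)

    Simulates : Fin (nodes T) → Fin (nodes T′) → Set
    Simulates u w = ∃ λ r → r ℕ.< suc size × S.Height≤ r u × G.Realises w (S.code r u)

    simulates? : ∀ u w → Dec (Simulates u w)
    simulates? u w = anyUpTo? (λ r → S.height≤? r u ×-dec G.realises? w (S.code r u)) (suc size)

    simulates-label : ∀ {u w} → Simulates u w → label T′ w ≡ label T u
    simulates-label (zero  , _ , _ , w≡u , _) = w≡u
    simulates-label (suc _ , _ , _ , w≡u , _) = w≡u

    simulates-flat : ∀ {u c w} → label T c ≡ label T u → E T u c → Simulates u w → Simulates c w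
    simulates-flat {u} {c} {w} same e (r , r<1+size , h , real) =
      r , r<1+size , S.height≤-flat same e r h , realises-flat r real
      where
        realises-flat : ∀ r → G.Realises w (S.code r u) → G.Realises w (S.code r c)
        realises-flat zero    (w≡u , _)     = trans w≡u (sym same) , tt
        realises-flat (suc r) (w≡u , below) =
          trans w≡u (sym same) , G.realisesBelowAll-⊆ (S.childCodes-flat same e r) below

    simulates-rise : ∀ {u c w} → S.Rise u c → Simulates u w →
                     ∃ λ w′ → Star (E T′) w w′ × Simulates c w′
    simulates-rise     rise (zero  , _ , h , _) = ⊥-elim (h _ rise)
    simulates-rise {u} {c} rise (suc r , r<size , h , _ , below) =
      let w′ , s , real = All.lookup (G.RealisesBelowAll⇒All below)
                            (∈-filter⁺ (S.childCode? r u) (S.code∈codes r c) (c , rise , refl))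
      in w′ , s , r , ℕ.<-trans (n<1+n r) r<size , h c rise , real

    simulates-step : ∀ {u c w} → Simulates u w → E T u c → ∃ λ w′ → Star (E T′) w w′ × Simulates c w′
    simulates-step {u} {c} {w} sim e with label T c ≟ label T u
    ... | yes same = w , ε , simulates-flat same e sim
    ... | no  c≢u  = simulates-rise (e ◅ ε , c≢u) sim

    -- The image of a node must not depend on the path used to reach it, so the
    -- target is chosen by a decision procedure rather than read off simulates-step.
    descend : Fin (nodes T) → Fin (nodes T′) → Fin (nodes T′)
    descend c w with any? (λ w′ → G.Star? w w′ ×-dec simulates? c w′)
    ... | yes (w′ , _) = w′
    ... | no  _        = w

    descend-correct : ∀ {c w} → (∃ λ w′ → Star (E T′) w w′ × Simulates c w′) →
                      Star (E T′) w (descend c w) × Simulates c (descend c w)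
    descend-correct {c} {w} ∃w′ with any? (λ w′ → G.Star? w w′ ×-dec simulates? c w′)
    ... | yes (_ , ok) = ok
    ... | no  ∄        = contradiction ∃w′ ∄

    embedding : ∀ {w₀} → Simulates S.root w₀ → PEmbedding P T T′
    embedding {w₀} sim₀ = f , f-edge , f-label
      where
        f : Fin (nodes T) → Fin (nodes T′)
        f u = S.foldPath descend w₀ (S.pathTo u)

        simulates-along : ∀ {u} (p : S.Path u) → Simulates u (S.foldPath descend w₀ p)
        simulates-along S.origin  = sim₀
        simulates-along (p S.▸ e) = proj₂ (descend-correct (simulates-step (simulates-along p) e))

        f-step : ∀ {i j} (e : E T i j) → f j ≡ descend j (f i)
        f-step {i} {j} e = S.foldPath-unique descend w₀ (S.pathTo j) (S.pathTo i S.▸ e)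

        f-edge : ∀ {i j} → E T i j → Star (E T′) (f i) (f j)
        f-edge {i} e = subst (Star (E T′) (f i)) (sym (f-step e))
          (proj₁ (descend-correct (simulates-step (simulates-along (S.pathTo i)) e)))

        f-label : ∀ u → label T u ≡ label T′ (f u)
        f-label u = sym (simulates-label (simulates-along (S.pathTo u)))

  rootCode : PTree P → Code
  rootCode T = Coding.code T size (Coding.root T)

  rootCode≡⇒PEmbedding : ∀ {T T′} → rootCode T ≡ rootCode T′ → PEmbedding P T T′
  rootCode≡⇒PEmbedding {T} {T′} same =
    Embedding.embedding T T′
      (size , n<1+n size , S.height≤size S.root ,
       subst (G.Realises G.root) (sym same) (G.realises-code size G.root))
    where
      module S = Coding T
      module G = Coding T′

lemma10 : (P : FinitePoset) → (T : ℕ → PTree P) → ∃[ n ] Dreary P T n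
lemma10 P T with repetition (codes P size) (rootCode P ∘ T) (λ n → Coding.code∈codes P (T n) size _)
  where open FinitePoset P using (size)
... | m , n , 1≤m , m<n , same =
  n , m , 1≤m , m<n , rootCode≡⇒PEmbedding P same , rootCode≡⇒PEmbedding P (sym same)
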